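{- Let $G$ and $H$ be graphs, each having at least four vertices and each having a universal vertex. Then $\gamma_{R}(G\times H)=6$.
   Context: All graphs are finite and simple. A vertex is universal if it is adjacent to all other vertices. The direct product $G\times H$ has vertex set $V(G)\times V(H)$, with $(u,v)$ adjacent to $(u',v')$ iff $uu'\in E(G)$ and $vv'\in E(H)$. A Roman dominating function on a graph $X$ is $f:V(X)\to\{0,1,2\}$ such that every vertex with value $0$ has a neighbor with value $2$; $\gamma_R(X)$ is the minimum of $\sum_v f(v)$ over such $f$. -}

module Defs where

open import Data.Nat using (ℕ; zero; suc; _+_; _≤_)
open import Data.Fin using (Fin)
open import Data.Fin.Properties using ()
open import Data.Product using (_×_; _,_; Σ; ∃; ∃-syntax)
open import Data.Sum using (_⊎_)
open import Data.Empty using (⊥)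
open import Relation.Nullary using (¬_; Dec)
open import Relation.Binary.PropositionalEquality using (_≡_)
open import Level using (0ℓ; suc)
open import Data.Vec.Functional using (Vector; foldr)

record Graph (n : ℕ) : Set₁ where
  field
    Adj   : Fin n → Fin n → Set
    sym   : ∀ {u v} → Adj u v → Adj v u
    irrefl : ∀ {u} → ¬ Adj u u
    dec   : ∀ u v → Dec (Adj u v)
open Graph public

Universal : ∀ {n} → Graph n → Fin n → Set
Universal G u = ∀ v → ¬ (v ≡ u) → Adj G u v

HasUniversal : ∀ {n} → Graph n → Set
HasUniversal G = ∃[ u ] Universal G u

Σ-fin : ∀ {n} → (Fin n → ℕ) → ℕ
Σ-fin {n} f = foldr _+_ 0 f

Vtx× : ℕ → ℕ → Set
Vtx× m n = Fin m × Fin n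

Adj× : ∀ {m n} → Graph m → Graph n → Vtx× m n → Vtx× m n → Set
Adj× G H (u , v) (u' , v') = Adj G u u' × Adj H v v'

IsRDF× : ∀ {m n} → Graph m → Graph n → (Vtx× m n → ℕ) → Set
IsRDF× G H f =
  (∀ x → f x ≤ 2) ×
  (∀ x → f x ≡ 0 → ∃[ y ] (Adj× G H x y × f y ≡ 2))

weight× : ∀ {m n} → (Vtx× m n → ℕ) → ℕ
weight× {m} {n} f = Σ-fin {m} (λ u → Σ-fin {n} (λ v → f (u , v)))

γR×≡ : ∀ {m n} → Graph m → Graph n → ℕ → Set
γR×≡ G H k =
  (∃[ f ] (IsRDF× G H f × weight× f ≡ k)) ×
  (∀ f → IsRDF× G H f → k ≤ weight× f)

-- The three vertices (u,v), (x,v), (u,y), with u and v universal and x ≠ u, y ≠ v, take value 2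
-- and dominate every other vertex: one off row u and column v sees (u,v), one in row u sees
-- (x,v), one in column v sees (u,y).  For the lower bound, two vertices in a common row or column
-- of G × H are never adjacent, so a vertex aligned with every vertex of value 2 is not dominated
-- and has value at least 1.  With no vertex of value 2 every value is positive; with one, its row
-- together with one more vertex of its column already weighs n + 2; with two, their common row or
-- column, or else their two rows, weigh at least 6; three vertices of value 2 weigh 6 on their own.
module Submission where

open import Defs hiding (sym)
open import Data.Nat using (ℕ; zero; suc; _+_; _≤_; z≤n; s≤s)
import Data.Nat as ℕ
open import Data.Nat.Properties
  using ( +-assoc; +-identityʳ; ≤-trans; ≤-refl; ≤-reflexive; m≤m+n; +-mono-≤; +-monoˡ-≤; +-monoʳ-≤
        ; n≢0⇒n>0; 1+n≢0; +-0-commutativeMonoid; module ≤-Reasoning)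
open import Data.Fin using (Fin; zero; suc; punchIn; punchOut)
open import Data.Fin.Properties using (_≟_; any?; punchInᵢ≢i; punchIn-punchOut)
open import Data.Vec.Functional using (removeAt)
open import Data.Bool using (true; false; if_then_else_)
open import Data.Product using (_×_; _,_; ∃; ∃-syntax; proj₁; proj₂)
open import Data.Product.Properties using (≡-dec)
open import Data.Sum using (_⊎_; inj₁; inj₂)
open import Data.Empty using (⊥-elim)
open import Function using (_∘_; case_of_)
open import Relation.Nullary using (¬_; Dec; yes; no; does)
open import Relation.Nullary.Decidable
  using (dec-true; dec-false; decidable-stable; map′; ¬?; _×-dec_)
open import Relation.Unary using (Decidable)
open import Relation.Binary.Definitions using (DecidableEquality)
open import Relation.Binary.PropositionalEquality using (_≡_; _≢_; refl; sym; trans; cong; cong₂)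
open import Algebra.Properties.CommutativeMonoid.Sum +-0-commutativeMonoid
  using (sum; sum-remove; sum-cong-≗; sum-replicate-zero; ∑-distrib-+)

open ≤-Reasoning

sum-mono : ∀ {n} {g h : Fin n → ℕ} → (∀ i → g i ≤ h i) → sum g ≤ sum h
sum-mono {zero}  g≤h = z≤n
sum-mono {suc n} g≤h = +-mono-≤ (g≤h zero) (sum-mono (g≤h ∘ suc))

size≤sum : ∀ {n} (g : Fin n → ℕ) → (∀ i → 1 ≤ g i) → n ≤ sum g
size≤sum {zero}  g positive = z≤n
size≤sum {suc n} g positive = +-mono-≤ (positive zero) (size≤sum (g ∘ suc) (positive ∘ suc))

entry≤sum : ∀ {n} (g : Fin n → ℕ) i → g i ≤ sum g
entry≤sum {suc n} g i = begin
  g i                          ≤⟨ m≤m+n (g i) _ ⟩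
  g i + sum (removeAt g i)     ≡⟨ sum-remove g ⟨
  sum g                        ∎

entries≤sum : ∀ {n} (g : Fin n → ℕ) {i j} → i ≢ j → g i + g j ≤ sum g
entries≤sum {suc n} g {i} {j} i≢j = begin
  g i + g j                                  ≡⟨ cong (λ k → g i + g k) (punchIn-punchOut i≢j) ⟨
  g i + removeAt g i (punchOut i≢j)          ≤⟨ +-monoʳ-≤ (g i) (entry≤sum (removeAt g i) _) ⟩
  g i + sum (removeAt g i)                   ≡⟨ sum-remove g ⟨
  sum g                                      ∎

entry+size≤sum : ∀ {n} (g : Fin (suc n) → ℕ) → (∀ k → 1 ≤ g k) → ∀ i → g i + n ≤ sum g
entry+size≤sum {n} g positive i = begin
  g i + n                    ≤⟨ +-monoʳ-≤ (g i) (size≤sum (removeAt g i) (positive ∘ punchIn i)) ⟩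
  g i + sum (removeAt g i)   ≡⟨ sum-remove g ⟨
  sum g                      ∎

entries+size≤sum : ∀ {n} (g : Fin (suc (suc n)) → ℕ) → (∀ k → 1 ≤ g k) →
                   ∀ {i j} → i ≢ j → g i + g j + n ≤ sum g
entries+size≤sum {n} g positive {i} {j} i≢j = begin
  g i + g j + n                                  ≡⟨ +-assoc (g i) (g j) n ⟩
  g i + (g j + n)                                ≡⟨ cong (λ k → g i + (g k + n)) (punchIn-punchOut i≢j) ⟨
  g i + (removeAt g i (punchOut i≢j) + n)
    ≤⟨ +-monoʳ-≤ (g i) (entry+size≤sum (removeAt g i) (positive ∘ punchIn i) _) ⟩
  g i + sum (removeAt g i)                       ≡⟨ sum-remove g ⟨
  sum g                                          ∎

point : ∀ {n} → Fin n → ℕ → Fin n → ℕ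
point i c k = if does (k ≟ i) then c else 0

point-self : ∀ {n} (i : Fin n) c → point i c i ≡ c
point-self i c rewrite dec-true (i ≟ i) refl = refl

point-other : ∀ {n} {i k : Fin n} c → k ≢ i → point i c k ≡ 0
point-other {i = i} {k} c k≢i rewrite dec-false (k ≟ i) k≢i = refl

sum-point : ∀ {n} (i : Fin n) c → sum (point i c) ≡ c
sum-point {suc n} i c = begin-equality
  sum (point i c)                        ≡⟨ sum-remove {i = i} (point i c) ⟩
  point i c i + sum (removeAt (point i c) i)
    ≡⟨ cong₂ _+_ (point-self i c) (sum-cong-≗ (λ k → point-other c (punchInᵢ≢i i k))) ⟩
  c + sum {n} (λ _ → 0)                  ≡⟨ cong (c +_) (sum-replicate-zero n) ⟩
  c + 0                                  ≡⟨ +-identityʳ c ⟩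
  c                                      ∎

sum-inside-point : ∀ {m n} (a : Fin m) (h : Fin n → ℕ) u →
                   sum (λ v → point a (h v) u) ≡ point a (sum h) u
sum-inside-point {n = n} a h u with does (u ≟ a)
... | true  = refl
... | false = sum-replicate-zero n

_≟ᵥ_ : ∀ {m n} → DecidableEquality (Vtx× m n)
_≟ᵥ_ = ≡-dec _≟_ _≟_

-- Σ-fin (hence weight×) and the library's sum are both foldr _+_ 0, so the lemmas on sum apply directly.
weight-mono : ∀ {m n} {f g : Vtx× m n → ℕ} → (∀ x → f x ≤ g x) → weight× f ≤ weight× g
weight-mono f≤g = sum-mono (λ u → sum-mono (λ v → f≤g (u , v)))

weight-+ : ∀ {m n} (f g : Vtx× m n → ℕ) → weight× (λ x → f x + g x) ≡ weight× f + weight× g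
weight-+ f g = begin-equality
  weight× (λ x → f x + g x)
    ≡⟨ sum-cong-≗ (λ u → ∑-distrib-+ (λ v → f (u , v)) (λ v → g (u , v))) ⟩
  sum (λ u → sum (λ v → f (u , v)) + sum (λ v → g (u , v)))
    ≡⟨ ∑-distrib-+ (λ u → sum (λ v → f (u , v))) (λ u → sum (λ v → g (u , v))) ⟩
  weight× f + weight× g ∎

vertexPoint : ∀ {m n} → Vtx× m n → ℕ → Vtx× m n → ℕ
vertexPoint (a , b) c (u , v) = point a (point b c v) u

weight-vertexPoint : ∀ {m n} (p : Vtx× m n) c → weight× (vertexPoint p c) ≡ c
weight-vertexPoint (a , b) c = begin-equality
  sum (λ u → sum (λ v → point a (point b c v) u)) ≡⟨ sum-cong-≗ (sum-inside-point a (point b c)) ⟩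
  sum (point a (sum (point b c)))                 ≡⟨ cong (sum ∘ point a) (sum-point b c) ⟩
  sum (point a c)                                 ≡⟨ sum-point a c ⟩
  c                                               ∎

vertexPoint-self : ∀ {m n} (p : Vtx× m n) c → vertexPoint p c p ≡ c
vertexPoint-self (a , b) c rewrite point-self b c = point-self a c

vertexPoint-other : ∀ {m n} {p x : Vtx× m n} c → x ≢ p → vertexPoint p c x ≡ 0
vertexPoint-other {p = a , b} {u , v} c x≢p with u ≟ a
... | no _     = refl
... | yes refl = point-other c (x≢p ∘ cong (u ,_))

twoOn : ∀ {m n} → Vtx× m n → Vtx× m n → Vtx× m n → Vtx× m n → ℕ
twoOn p q r x = vertexPoint p 2 x + vertexPoint q 2 x + vertexPoint r 2 x

weight-twoOn : ∀ {m n} (p q r : Vtx× m n) → weight× (twoOn p q r) ≡ 6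
weight-twoOn p q r = begin-equality
  weight× (twoOn p q r)
    ≡⟨ weight-+ (λ x → vertexPoint p 2 x + vertexPoint q 2 x) (vertexPoint r 2) ⟩
  weight× (λ x → vertexPoint p 2 x + vertexPoint q 2 x) + weight× (vertexPoint r 2)
    ≡⟨ cong (_+ weight× (vertexPoint r 2)) (weight-+ (vertexPoint p 2) (vertexPoint q 2)) ⟩
  weight× (vertexPoint p 2) + weight× (vertexPoint q 2) + weight× (vertexPoint r 2)
    ≡⟨ cong₂ _+_ (cong₂ _+_ (weight-vertexPoint p 2) (weight-vertexPoint q 2))
                 (weight-vertexPoint r 2) ⟩
  6 ∎

module _ {m n} {p q r : Vtx× m n} (p≢q : p ≢ q) (p≢r : p ≢ r) (q≢r : q ≢ r) where

  twoOn-at : ∀ {x} → x ≡ p ⊎ x ≡ q ⊎ x ≡ r → twoOn p q r x ≡ 2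
  twoOn-at (inj₁ refl)
    rewrite vertexPoint-self p 2 | vertexPoint-other 2 p≢q | vertexPoint-other 2 p≢r = refl
  twoOn-at (inj₂ (inj₁ refl))
    rewrite vertexPoint-other 2 (p≢q ∘ sym) | vertexPoint-self q 2 | vertexPoint-other 2 q≢r = refl
  twoOn-at (inj₂ (inj₂ refl))
    rewrite vertexPoint-other 2 (p≢r ∘ sym) | vertexPoint-other 2 (q≢r ∘ sym) | vertexPoint-self r 2 = refl

  twoOn-≤ : ∀ {h : Vtx× m n → ℕ} → 2 ≤ h p → 2 ≤ h q → 2 ≤ h r → ∀ x → twoOn p q r x ≤ h x
  twoOn-≤ {h} 2≤hp 2≤hq 2≤hr x with x ≟ᵥ p | x ≟ᵥ q | x ≟ᵥ r
  ... | yes refl | _        | _        = ≤-trans (≤-reflexive (twoOn-at (inj₁ refl))) 2≤hp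
  ... | no _     | yes refl | _        = ≤-trans (≤-reflexive (twoOn-at (inj₂ (inj₁ refl)))) 2≤hq
  ... | no _     | no _     | yes refl = ≤-trans (≤-reflexive (twoOn-at (inj₂ (inj₂ refl)))) 2≤hr
  ... | no x≢p   | no x≢q   | no x≢r
    rewrite vertexPoint-other 2 x≢p | vertexPoint-other 2 x≢q | vertexPoint-other 2 x≢r = z≤n

module _ {m n} {G : Graph m} {H : Graph n} {u x : Fin m} {v y : Fin n}
         (u-universal : Universal G u) (v-universal : Universal H v)
         (x≢u : x ≢ u) (y≢v : y ≢ v) where

  private
    twos : Vtx× m n → ℕ
    twos = twoOn (u , v) (x , v) (u , y)

    uv≢xv : (u , v) ≢ (x , v)
    uv≢xv = x≢u ∘ sym ∘ cong proj₁

    uv≢uy : (u , v) ≢ (u , y)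
    uv≢uy = y≢v ∘ sym ∘ cong proj₂

    xv≢uy : (x , v) ≢ (u , y)
    xv≢uy = x≢u ∘ cong proj₁

    twos-at : ∀ {z} → z ≡ (u , v) ⊎ z ≡ (x , v) ⊎ z ≡ (u , y) → twos z ≡ 2
    twos-at = twoOn-at uv≢xv uv≢uy xv≢uy

    twos≤2 : ∀ z → twos z ≤ 2
    twos≤2 = twoOn-≤ uv≢xv uv≢uy xv≢uy ≤-refl ≤-refl ≤-refl

    adjacent-to-u : ∀ {s} → s ≢ u → Adj G s u
    adjacent-to-u s≢u = Graph.sym G (u-universal _ s≢u)

    adjacent-to-v : ∀ {t} → t ≢ v → Adj H t v
    adjacent-to-v t≢v = Graph.sym H (v-universal _ t≢v)

    dominated : ∀ z → z ≢ (u , v) → ∃[ w ] (Adj× G H z w × twos w ≡ 2)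
    dominated (s , t) z≢uv with s ≟ u | t ≟ v
    ... | yes refl | yes refl = ⊥-elim (z≢uv refl)
    ... | yes refl | no t≢v   = (x , v) , (u-universal x x≢u , adjacent-to-v t≢v) , twos-at (inj₂ (inj₁ refl))
    ... | no s≢u   | yes refl = (u , y) , (adjacent-to-u s≢u , v-universal y y≢v) , twos-at (inj₂ (inj₂ refl))
    ... | no s≢u   | no t≢v   = (u , v) , (adjacent-to-u s≢u , adjacent-to-v t≢v) , twos-at (inj₁ refl)

    dominating : ∀ z → twos z ≡ 0 → ∃[ w ] (Adj× G H z w × twos w ≡ 2)
    dominating z twos-z≡0 with z ≟ᵥ (u , v)
    ... | yes refl = ⊥-elim (1+n≢0 (trans (sym (twos-at (inj₁ refl))) twos-z≡0))
    ... | no z≢uv  = dominated z z≢uv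

  universal-RDF-of-weight-6 : ∃[ f ] (IsRDF× G H f × weight× f ≡ 6)
  universal-RDF-of-weight-6 = twos , (twos≤2 , dominating) , weight-twoOn (u , v) (x , v) (u , y)

data Census {A : Set} (P : A → Set) : Set where
  none  : (∀ x → ¬ P x) → Census P
  one   : ∀ {p} → P p → (∀ {x} → P x → x ≡ p) → Census P
  two   : ∀ {p q} → p ≢ q → P p → P q → (∀ {x} → P x → x ≡ p ⊎ x ≡ q) → Census P
  three : ∀ {p q r} → p ≢ q → p ≢ r → q ≢ r → P p → P q → P r → Census P

census : ∀ {A : Set} → DecidableEquality A → (∀ {Q : A → Set} → Decidable Q → Dec (∃ Q)) →
         ∀ {P : A → Set} → Decidable P → Census P
census _≟ₐ_ search {P} P? with search P?
... | no ∄P = none (λ x Px → ∄P (x , Px))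
... | yes (p , Pp) with search (λ x → P? x ×-dec ¬? (x ≟ₐ p))
...   | no ∄q = one Pp (λ {x} Px → decidable-stable (x ≟ₐ p) (λ x≢p → ∄q (x , Px , x≢p)))
...   | yes (q , Pq , q≢p) with search (λ x → P? x ×-dec ¬? (x ≟ₐ p) ×-dec ¬? (x ≟ₐ q))
...     | yes (r , Pr , r≢p , r≢q) = three (q≢p ∘ sym) (r≢p ∘ sym) (r≢q ∘ sym) Pp Pq Pr
...     | no ∄r = two (q≢p ∘ sym) Pp Pq p-or-q
  where
  p-or-q : ∀ {x} → P x → x ≡ p ⊎ x ≡ q
  p-or-q {x} Px with x ≟ₐ p
  ... | yes x≡p = inj₁ x≡p
  ... | no x≢p  = inj₂ (decidable-stable (x ≟ₐ q) (λ x≢q → ∄r (x , Px , x≢p , x≢q)))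

searchᵥ : ∀ {m n} {Q : Vtx× m n → Set} → Decidable Q → Dec (∃ Q)
searchᵥ Q? = map′ (λ (u , v , Quv) → (u , v) , Quv) (λ ((u , v) , Quv) → u , v , Quv)
                  (any? λ u → any? λ v → Q? (u , v))

module _ {m n} (f : Vtx× m n → ℕ) where

  row : Fin m → ℕ
  row a = sum (λ v → f (a , v))

  column : Fin n → ℕ
  column b = sum (λ u → f (u , b))

  row≤weight : ∀ a → row a ≤ weight× f
  row≤weight = entry≤sum row

  rows≤weight : ∀ {a c} → a ≢ c → row a + row c ≤ weight× f
  rows≤weight = entries≤sum row

  column≤weight : ∀ b → column b ≤ weight× f
  column≤weight b = sum-mono (λ u → entry≤sum (λ v → f (u , v)) b)

Aligned : ∀ {m n} → Vtx× m n → Vtx× m n → Set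
Aligned (a , b) (c , d) = a ≡ c ⊎ b ≡ d

adjacent⇒¬aligned : ∀ {m n} {G : Graph m} {H : Graph n} {x y} → Adj× G H x y → ¬ Aligned x y
adjacent⇒¬aligned {G = G} (adjG , _) (inj₁ refl) = irrefl G adjG
adjacent⇒¬aligned {H = H} (_ , adjH) (inj₂ refl) = irrefl H adjH

module _ {m n} {G : Graph (4 + m)} {H : Graph (4 + n)} {f : Vtx× (4 + m) (4 + n) → ℕ}
         (dominating : ∀ x → f x ≡ 0 → ∃[ y ] (Adj× G H x y × f y ≡ 2)) where

  positive-if-aligned : ∀ x → (∀ {y} → f y ≡ 2 → Aligned x y) → 1 ≤ f x
  positive-if-aligned x aligned = n≢0⇒n>0 λ fx≡0 →
    let (y , x~y , fy≡2) = dominating x fx≡0 in adjacent⇒¬aligned {G = G} {H} x~y (aligned fy≡2)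

  positive-if-aligned₁ : ∀ {p x} → (∀ {y} → f y ≡ 2 → y ≡ p) → Aligned x p → 1 ≤ f x
  positive-if-aligned₁ {x = x} only x~p =
    positive-if-aligned x λ fy≡2 → case only fy≡2 of λ { refl → x~p }

  positive-if-aligned₂ : ∀ {p q x} → (∀ {y} → f y ≡ 2 → y ≡ p ⊎ y ≡ q) →
                         Aligned x p → Aligned x q → 1 ≤ f x
  positive-if-aligned₂ {x = x} only x~p x~q =
    positive-if-aligned x λ fy≡2 →
      case only fy≡2 of λ { (inj₁ refl) → x~p ; (inj₂ refl) → x~q }

  6≤weight-without-twos : (∀ x → f x ≢ 2) → 6 ≤ weight× f
  6≤weight-without-twos no-twos = begin
    6                              ≤⟨ +-mono-≤ (m≤m+n 4 n) (m≤m+n 2 (2 + n)) ⟩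
    (4 + n) + (4 + n)              ≤⟨ +-mono-≤ (size≤sum _ (positive ∘ (zero ,_)))
                                               (size≤sum _ (positive ∘ (suc zero ,_))) ⟩
    row f zero + row f (suc zero)  ≤⟨ rows≤weight f (λ ()) ⟩
    weight× f                      ∎
    where
    positive : ∀ x → 1 ≤ f x
    positive x = positive-if-aligned x (⊥-elim ∘ no-twos _)

  6≤weight-with-one-two : ∀ {a b} → f (a , b) ≡ 2 → (∀ {y} → f y ≡ 2 → y ≡ (a , b)) → 6 ≤ weight× f
  6≤weight-with-one-two {a} {b} fab≡2 only = begin
    6                          ≤⟨ +-monoˡ-≤ 1 (m≤m+n 5 n) ⟩
    2 + (3 + n) + 1            ≡⟨ cong (λ k → k + (3 + n) + 1) fab≡2 ⟨
    f (a , b) + (3 + n) + 1    ≤⟨ +-mono-≤ (entry+size≤sum (λ v → f (a , v)) (λ _ → positive (inj₁ refl)) b)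
                                           (≤-trans (positive (inj₂ refl)) (entry≤sum (λ v → f (x , v)) b)) ⟩
    row f a + row f x          ≤⟨ rows≤weight f (punchInᵢ≢i a zero ∘ sym) ⟩
    weight× f                  ∎
    where
    x : Fin (4 + m)
    x = punchIn a zero
    positive : ∀ {z} → Aligned z (a , b) → 1 ≤ f z
    positive = positive-if-aligned₁ only

  6≤weight-with-two-twos : ∀ {a b c d} → (a , b) ≢ (c , d) → f (a , b) ≡ 2 → f (c , d) ≡ 2 →
                           (∀ {y} → f y ≡ 2 → y ≡ (a , b) ⊎ y ≡ (c , d)) → 6 ≤ weight× f
  6≤weight-with-two-twos {a} {b} {c} {d} ab≢cd fab≡2 fcd≡2 only with a ≟ c | b ≟ d
  ... | yes refl | yes refl = ⊥-elim (ab≢cd refl)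
  ... | yes refl | no b≢d = begin
    6                                ≤⟨ m≤m+n 6 n ⟩
    2 + 2 + (2 + n)                  ≡⟨ cong₂ (λ k l → k + l + (2 + n)) fab≡2 fcd≡2 ⟨
    f (a , b) + f (a , d) + (2 + n)  ≤⟨ entries+size≤sum (λ v → f (a , v))
                                          (λ _ → positive-if-aligned₂ only (inj₁ refl) (inj₁ refl)) b≢d ⟩
    row f a                          ≤⟨ row≤weight f a ⟩
    weight× f                        ∎
  ... | no a≢c | yes refl = begin
    6                                ≤⟨ m≤m+n 6 m ⟩
    2 + 2 + (2 + m)                  ≡⟨ cong₂ (λ k l → k + l + (2 + m)) fab≡2 fcd≡2 ⟨
    f (a , b) + f (c , b) + (2 + m)  ≤⟨ entries+size≤sum (λ u → f (u , b))
                                          (λ _ → positive-if-aligned₂ only (inj₂ refl) (inj₂ refl)) a≢c ⟩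
    column f b                       ≤⟨ column≤weight f b ⟩
    weight× f                        ∎
  ... | no a≢c | no b≢d = begin
    2 + 1 + (2 + 1)                                  ≤⟨ +-mono-≤ (+-mono-≤ (≤-reflexive (sym fab≡2)) fad≥1)
                                                                 (+-mono-≤ (≤-reflexive (sym fcd≡2)) fcb≥1) ⟩
    f (a , b) + f (a , d) + (f (c , d) + f (c , b))  ≤⟨ +-mono-≤ (entries≤sum (λ v → f (a , v)) b≢d)
                                                                 (entries≤sum (λ v → f (c , v)) (b≢d ∘ sym)) ⟩
    row f a + row f c                                ≤⟨ rows≤weight f a≢c ⟩
    weight× f                                        ∎
    where
    fad≥1 : 1 ≤ f (a , d)
    fad≥1 = positive-if-aligned₂ only (inj₁ refl) (inj₂ refl)
    fcb≥1 : 1 ≤ f (c , b)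
    fcb≥1 = positive-if-aligned₂ only (inj₂ refl) (inj₁ refl)

  6≤weight-with-three-twos : ∀ {p q r} → p ≢ q → p ≢ r → q ≢ r →
                             f p ≡ 2 → f q ≡ 2 → f r ≡ 2 → 6 ≤ weight× f
  6≤weight-with-three-twos {p} {q} {r} p≢q p≢r q≢r fp≡2 fq≡2 fr≡2 = begin
    6                      ≡⟨ weight-twoOn p q r ⟨
    weight× (twoOn p q r)  ≤⟨ weight-mono (twoOn-≤ p≢q p≢r q≢r (two≤ fp≡2) (two≤ fq≡2) (two≤ fr≡2)) ⟩
    weight× f              ∎
    where
    two≤ : ∀ {x} → f x ≡ 2 → 2 ≤ f x
    two≤ = ≤-reflexive ∘ sym

  6≤weight : 6 ≤ weight× f
  6≤weight with census _≟ᵥ_ searchᵥ (λ x → f x ℕ.≟ 2)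
  ... | none no-twos                      = 6≤weight-without-twos no-twos
  ... | one fp≡2 only                     = 6≤weight-with-one-two fp≡2 only
  ... | two p≢q fp≡2 fq≡2 only            = 6≤weight-with-two-twos p≢q fp≡2 fq≡2 only
  ... | three p≢q p≢r q≢r fp≡2 fq≡2 fr≡2  = 6≤weight-with-three-twos p≢q p≢r q≢r fp≡2 fq≡2 fr≡2

proposition2p7 : (m n : ℕ) → 4 ≤ m → 4 ≤ n → (G : Graph m) → (H : Graph n) →
    HasUniversal G → HasUniversal H → γR×≡ G H 6
proposition2p7 _ _ (s≤s (s≤s (s≤s (s≤s _)))) (s≤s (s≤s (s≤s (s≤s _)))) G H
               (u , u-universal) (v , v-universal) =
  universal-RDF-of-weight-6 {G = G} {H} u-universal v-universal
                            (punchInᵢ≢i u zero) (punchInᵢ≢i v zero) ,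
  λ _ (_ , dominating) → 6≤weight {G = G} {H} dominating
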